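{- For every $d\in\mathbb{N}$ there exists a function $f\colon\mathbb{N}\to\mathbb{N}$ such that for every graph $G$ we have $\chi_{\mathrm{sub}}(G^d)\leq f(\mathrm{wcol}_d(G))$.
   Context: All graphs are finite, simple and undirected. $G^d$ is the graph on $V(G)$ where distinct $u,v$ are adjacent iff their distance in $G$ is at most $d$. The subchromatic index $\chi_{\mathrm{sub}}(H)$ is the least $c$ such that $V(H)$ can be colored with $c$ colors with each color class inducing a disjoint union of complete graphs. For a vertex ordering (linear order) $\sigma$ of $G$, $r\in\mathbb{N}$, and vertices $v\leq_\sigma u$, $v$ is weakly $r$-reachable from $u$ if there is a path of length at most $r$ from $u$ to $v$ all of whose vertices are not placed before $v$ in $\sigma$; $\mathrm{WReach}_r[G,\sigma,u]$ is the set of such $v$ (including $u$); $\mathrm{wcol}_r(G,\sigma)=\max_u|\mathrm{WReach}_r[G,\sigma,u]|$ and $\mathrm{wcol}_r(G)=\min_\sigma\mathrm{wcol}_r(G,\sigma)$. -}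

module Defs where

open import Data.Nat using (ℕ; zero; suc; _≤_)
open import Data.Fin using (Fin; toℕ)
open import Data.Bool using (Bool; true; false)
open import Data.List using (List; []; _∷_; length)
open import Data.List.Relation.Unary.All using (All)
open import Data.List.Relation.Unary.Unique.Propositional using (Unique)
open import Data.Product using (Σ; ∃; _×_; _,_)
open import Relation.Binary.PropositionalEquality using (_≡_; _≢_)
open import Relation.Nullary using (¬_)
open import Function.Definitions using (Injective)

record Graph : Set where
  field
    n      : ℕ
    Adj    : Fin n → Fin n → Bool
    sym    : ∀ u v → Adj u v ≡ Adj v u
    irrefl : ∀ u → Adj u u ≡ false

open Graph public

data Walk (G : Graph) : Fin (n G) → Fin (n G) → Set where
  []  : ∀ {u} → Walk G u u
  _∷_ : ∀ {u w v} → Adj G u w ≡ true → Walk G w v → Walk G u v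

len : ∀ {G u v} → Walk G u v → ℕ
len []       = 0
len (_ ∷ p)  = suc (len p)

verts : ∀ {G u v} → Walk G u v → List (Fin (n G))
verts {u = u} []      = u ∷ []
verts {u = u} (_ ∷ p) = u ∷ verts p

IsPath : ∀ {G u v} → Walk G u v → Set
IsPath p = Unique (verts p)

DistAtMost : (G : Graph) → ℕ → Fin (n G) → Fin (n G) → Set
DistAtMost G d u v = Σ (Walk G u v) λ p → IsPath p × len p ≤ d

PowAdj : (G : Graph) → ℕ → Fin (n G) → Fin (n G) → Set
PowAdj G d u v = u ≢ v × DistAtMost G d u v

-- A vertex colouring with c colours of a graph on Fin m (adjacency R) in which
-- every colour class induces a disjoint union of complete graphs: inside each colour
-- class, vertices are partitioned into parts (labelled by `part`), distinct vertices
-- of the same part are adjacent, and vertices of distinct parts are non-adjacent.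
SubColouring : (m : ℕ) → (Fin m → Fin m → Set) → ℕ → Set
SubColouring m R c =
  Σ (Fin m → Fin c) λ col → Σ (Fin m → ℕ) λ part →
    ∀ u v → col u ≡ col v → u ≢ v →
      (part u ≡ part v → R u v) × (R u v → part u ≡ part v)

SubChromaticAtMost : (m : ℕ) → (Fin m → Fin m → Set) → ℕ → Set
SubChromaticAtMost m R c = SubColouring m R c

-- A vertex ordering (linear order) of G, given by an injective position map
-- Fin n → Fin n (hence a bijection); v ≤σ u iff pos v ≤ pos u.
record Ordering (G : Graph) : Set where
  field
    pos    : Fin (n G) → Fin (n G)
    posInj : Injective _≡_ _≡_ pos

open Ordering public

_≤[_]_ : ∀ {G} → Fin (n G) → Ordering G → Fin (n G) → Set
v ≤[ σ ] u = toℕ (pos σ v) ≤ toℕ (pos σ u)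

WReach : (G : Graph) → Ordering G → ℕ → Fin (n G) → Fin (n G) → Set
WReach G σ r u v =
  v ≤[ σ ] u ×
  Σ (Walk G u v) λ p → IsPath p × len p ≤ r × All (λ x → v ≤[ σ ] x) (verts p)

WcolOrdAtMost : (G : Graph) → Ordering G → ℕ → ℕ → Set
WcolOrdAtMost G σ r k =
  ∀ u (xs : List (Fin (n G))) → Unique xs → All (WReach G σ r u) xs → length xs ≤ k

WcolAtMost : Graph → ℕ → ℕ → Set
WcolAtMost G r k = ∃ λ (σ : Ordering G) → WcolOrdAtMost G σ r k

IsWcol : Graph → ℕ → ℕ → Set
IsWcol G r k = WcolAtMost G r k × (∀ j → WcolAtMost G r j → k ≤ j)

-- Fix an ordering σ with wcol_d(G, σ) ≤ k and put h = ⌊d/2⌋.  Greedily colour G with k + 1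
-- colours so that a vertex and any earlier vertex weakly d-reachable from it get distinct
-- colours; then every vertex weakly h-reachable from u is determined by u and its colour.
-- The subcolouring class of u records, for every colour γ, the distance from u to its
-- weakly h-reachable vertex m of colour γ together with the rank, among the weakly
-- d-reachable set of m, of the lowest vertex weakly h-reachable from u; the clique of u is
-- that lowest vertex.  Two vertices of the same class joined by a path of length ≤ d meet at
-- the lowest vertex m of the path, and the recorded data force their lowest vertices to agree.
module Submission where

open import Defs hiding (sym)
open import Data.Nat using (ℕ; zero; suc; _+_; _*_; _^_; _≤_; _<_; z≤n; s≤s; _≤?_; _<?_; ⌊_/2⌋; ⌈_/2⌉)
open import Data.Nat.Properties
open import Data.Fin as Fin using (Fin; toℕ; combine; fromℕ<; funToFin; finToFun)
import Data.Fin.Properties as Finₚ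
open import Data.Bool using (true)
import Data.Bool as Bool
open import Data.List using (List; []; _∷_; length; filter; map; allFin; upTo)
open import Data.List.Extrema.Nat using (argmin; argmin-all; argmin-sel; f[argmin]≤f[xs]; min; min≤⊤; min≤xs)
open import Data.List.Relation.Unary.All as All using (All; []; _∷_)
open import Data.List.Relation.Unary.All.Properties using (¬Any⇒All¬; all-filter; anti-mono)
open import Data.List.Relation.Unary.Any using (here; there)
open import Data.List.Relation.Unary.AllPairs using ([]; _∷_)
import Data.List.Relation.Unary.Any as Any
open import Data.List.Relation.Unary.Any.Properties using (lookup-index)
open import Data.List.Relation.Unary.Unique.Propositional.Properties using (filter⁺; allFin⁺)
open import Data.List.Relation.Binary.Subset.Propositional using (_⊆_)
open import Data.List.Membership.Propositional using (_∈_; _∉_)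
open import Data.List.Membership.Propositional.Properties using (∈-filter⁺; ∈-allFin; ∈-map⁺; ∈-upTo⁺)
import Data.List.Membership.DecPropositional as DecMembership
open import Data.List.Properties using (length-map)
open import Data.Product using (Σ; ∃; ∃₂; _×_; _,_; proj₁; proj₂)
open import Data.Sum using (_⊎_; inj₁; inj₂)
open import Relation.Binary.PropositionalEquality
open import Relation.Binary using (tri<; tri≈; tri>)
open import Relation.Nullary using (¬_; Dec; yes; no; contradiction)
open import Relation.Nullary.Decidable using (_×-dec_)
open import Relation.Unary using (Decidable)
open import Function using (_∘_; id)

module _ {A : Set} {P Q : A → Set} (P? : Decidable P) (Q? : Decidable Q)
         (P⇒Q : ∀ {z} → P z → Q z) where

  length-filter-mono : ∀ xs → length (filter P? xs) ≤ length (filter Q? xs)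
  length-filter-mono [] = z≤n
  length-filter-mono (x ∷ xs) with P? x | Q? x
  ... | yes _  | yes _  = s≤s (length-filter-mono xs)
  ... | yes px | no ¬qx = contradiction (P⇒Q px) ¬qx
  ... | no _   | yes _  = m≤n⇒m≤1+n (length-filter-mono xs)
  ... | no _   | no _   = length-filter-mono xs

  length-filter-mono-< : ∀ {w} xs → w ∈ xs → Q w → ¬ P w →
                         length (filter P? xs) < length (filter Q? xs)
  length-filter-mono-< (x ∷ xs) (here refl) qx ¬px with P? x | Q? x
  ... | yes px | _      = contradiction px ¬px
  ... | no _   | yes _  = s≤s (length-filter-mono xs)
  ... | no _   | no ¬qx = contradiction qx ¬qx
  length-filter-mono-< (x ∷ xs) (there w∈xs) qw ¬pw with P? x | Q? x
  ... | yes _  | yes _  = s≤s (length-filter-mono-< xs w∈xs qw ¬pw)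
  ... | yes px | no ¬qx = contradiction (P⇒Q px) ¬qx
  ... | no _   | yes _  = m<n⇒m<1+n (length-filter-mono-< xs w∈xs qw ¬pw)
  ... | no _   | no _   = length-filter-mono-< xs w∈xs qw ¬pw

∃∉-short : ∀ {k} (xs : List (Fin (suc k))) → length xs ≤ k → ∃ λ j → j ∉ xs
∃∉-short {k} xs |xs|≤k =
  Finₚ.¬∀⟶∃¬ (suc k) (_∈ xs) (λ j → DecMembership._∈?_ Fin._≟_ j xs) ¬all∈
  where
  ¬all∈ : ¬ (∀ j → j ∈ xs)
  ¬all∈ all∈ with Finₚ.pigeonhole (s≤s |xs|≤k) (Any.index ∘ all∈)
  ... | i , j , i<j , same-index =
    Finₚ.<-irrefl (trans (lookup-index (all∈ i))
                  (trans (cong (Data.List.lookup xs) same-index) (sym (lookup-index (all∈ j))))) i<j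

funToFin-injective : ∀ {m n} (f g : Fin m → Fin n) → funToFin f ≡ funToFin g → ∀ i → f i ≡ g i
funToFin-injective f g f≡g i = begin
  f i                     ≡⟨ sym (Finₚ.finToFun-funToFin f i) ⟩
  finToFun (funToFin f) i ≡⟨ cong (λ c → finToFun c i) f≡g ⟩
  finToFun (funToFin g) i ≡⟨ Finₚ.finToFun-funToFin g i ⟩
  g i                     ∎
  where open ≡-Reasoning

a≤⌊d/2⌋ : ∀ {a b d} → a ≤ b → a + b ≤ d → a ≤ ⌊ d /2⌋
a≤⌊d/2⌋ {a} {b} {d} a≤b a+b≤d = begin
  a             ≡⟨ n≡⌊n+n/2⌋ a ⟩
  ⌊ a + a /2⌋   ≤⟨ ⌊n/2⌋-mono (≤-trans (+-monoʳ-≤ a a≤b) a+b≤d) ⟩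
  ⌊ d /2⌋       ∎
  where open ≤-Reasoning

⌊d/2⌋+⌊d/2⌋≤d : ∀ d → ⌊ d /2⌋ + ⌊ d /2⌋ ≤ d
⌊d/2⌋+⌊d/2⌋≤d d = begin
  ⌊ d /2⌋ + ⌊ d /2⌋  ≤⟨ +-monoʳ-≤ ⌊ d /2⌋ (⌊n/2⌋≤⌈n/2⌉ d) ⟩
  ⌊ d /2⌋ + ⌈ d /2⌉  ≡⟨ ⌊n/2⌋+⌈n/2⌉≡n d ⟩
  d                  ∎
  where open ≤-Reasoning

module Greedy {m k} (rank : Fin m → ℕ) {B : Fin m → Fin m → Set} (B? : ∀ x → Decidable (B x))
              (B⇒rank< : ∀ {x y} → B x y → rank y < rank x)
              (few-back : ∀ x → length (filter (B? x) (allFin m)) ≤ k) where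

  backColours : (Fin m → Fin (suc k)) → Fin m → List (Fin (suc k))
  backColours c x = map c (filter (B? x) (allFin m))

  few-backColours : ∀ c x → length (backColours c x) ≤ k
  few-backColours c x = subst (_≤ k) (sym (length-map c (filter (B? x) (allFin m)))) (few-back x)

  freeColour : (Fin m → Fin (suc k)) → Fin m → Fin (suc k)
  freeColour c x = proj₁ (∃∉-short (backColours c x) (few-backColours c x))

  freeColour-avoids : ∀ c {x y} → B x y → freeColour c x ≢ c y
  freeColour-avoids c {x} {y} xBy free≡cy = proj₂ (∃∉-short (backColours c x) (few-backColours c x))
    (subst (_∈ backColours c x) (sym free≡cy) (∈-map⁺ c (∈-filter⁺ (B? x) (∈-allFin y) xBy)))

  -- colouring in which exactly the vertices of rank < q have received their final colour
  colourBelow : ℕ → Fin m → Fin (suc k)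
  colourBelow zero    x = Fin.zero
  colourBelow (suc q) x with rank x ≟ q
  ... | yes _ = freeColour (colourBelow q) x
  ... | no _  = colourBelow q x

  greedy : Fin m → Fin (suc k)
  greedy x = freeColour (colourBelow (rank x)) x

  colourBelow-final : ∀ q x → rank x < q → colourBelow q x ≡ greedy x
  colourBelow-final (suc q) x rank<q with rank x ≟ q
  ... | yes refl   = refl
  ... | no rank≢q = colourBelow-final q x (≤∧≢⇒< (≤-pred rank<q) rank≢q)

  greedy-proper : ∀ {x y} → B x y → greedy x ≢ greedy y
  greedy-proper {x} {y} xBy gx≡gy = freeColour-avoids (colourBelow (rank x)) xBy
    (trans gx≡gy (sym (colourBelow-final (rank x) y (B⇒rank< xBy))))

module WeakReachability (G : Graph) (σ : Ordering G) where

  V : Set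
  V = Fin (n G)

  position : V → ℕ
  position x = toℕ (pos σ x)

  _⪯_ : V → V → Set
  x ⪯ y = x ≤[ σ ] y

  _≺_ : V → V → Set
  x ≺ y = position x < position y

  position-injective : ∀ {x y} → position x ≡ position y → x ≡ y
  position-injective = posInj σ ∘ Finₚ.toℕ-injective

  injective-by-order : ∀ {A : Set} (f : V → A) {x y} →
                       (x ≺ y → f x ≢ f y) → (y ≺ x → f x ≢ f y) → f x ≡ f y → x ≡ y
  injective-by-order f {x} {y} x≺y⇒≢ y≺x⇒≢ fx≡fy with <-cmp (position x) (position y)
  ... | tri< x≺y _ _  = contradiction fx≡fy (x≺y⇒≢ x≺y)
  ... | tri≈ _ same _ = position-injective same
  ... | tri> _ _ y≺x  = contradiction fx≡fy (y≺x⇒≢ y≺x)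

  data WalkAbove (x : V) : ℕ → V → V → Set where
    stop : ∀ {t u} → x ⪯ u → WalkAbove x t u u
    step : ∀ {t u w v} → Adj G u w ≡ true → x ⪯ u → WalkAbove x t w v → WalkAbove x (suc t) u v

  _⇝[_]_ : V → ℕ → V → Set
  u ⇝[ t ] x = WalkAbove x t u x

  lengthen : ∀ {x t t′ u v} → t ≤ t′ → WalkAbove x t u v → WalkAbove x t′ u v
  lengthen t≤t′         (stop x⪯u)     = stop x⪯u
  lengthen (s≤s t≤t′) (step e x⪯u r) = step e x⪯u (lengthen t≤t′ r)

  lower : ∀ {x y t u v} → y ⪯ x → WalkAbove x t u v → WalkAbove y t u v
  lower y⪯x (stop x⪯u)     = stop (≤-trans y⪯x x⪯u)
  lower y⪯x (step e x⪯u r) = step e (≤-trans y⪯x x⪯u) (lower y⪯x r)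

  start-above : ∀ {x t u v} → WalkAbove x t u v → x ⪯ u
  start-above (stop x⪯u)     = x⪯u
  start-above (step _ x⪯u _) = x⪯u

  _++_ : ∀ {x a b u w v} → WalkAbove x a u w → WalkAbove x b w v → WalkAbove x (a + b) u v
  _++_ {a = a} (stop _) s = lengthen (m≤n+m _ a) s
  step e x⪯u r ++ s       = step e x⪯u (r ++ s)

  snoc : ∀ {x t u v w} → WalkAbove x t u v → Adj G v w ≡ true → x ⪯ w → WalkAbove x (suc t) u w
  snoc (stop x⪯u)     e x⪯w = step e x⪯u (stop x⪯w)
  snoc (step e x⪯u r) f x⪯w = step e x⪯u (snoc r f x⪯w)

  reverse : ∀ {x t u v} → WalkAbove x t u v → WalkAbove x t v u
  reverse (stop x⪯u)             = stop x⪯u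
  reverse (step {u = u} {w} e x⪯u r) = snoc (reverse r) (trans (Graph.sym G w u) e) x⪯u

  ⇝-through : ∀ {w y z a b} → z ⪯ y → w ⇝[ a ] y → w ⇝[ b ] z → y ⇝[ a + b ] z
  ⇝-through z⪯y w⇝y w⇝z = lower z⪯y (reverse w⇝y) ++ w⇝z

  walkAbove? : ∀ x t u v → Dec (WalkAbove x t u v)
  walkAbove? x zero u v with u Fin.≟ v | position x ≤? position u
  ... | yes refl | yes x⪯u = yes (stop x⪯u)
  ... | yes refl | no x⋠u  = no λ { (stop x⪯u) → x⋠u x⪯u }
  ... | no u≢v   | _       = no λ { (stop _) → u≢v refl }
  walkAbove? x (suc t) u v
    with u Fin.≟ v | position x ≤? position u
       | Finₚ.any? (λ w → (Adj G u w Bool.≟ true) ×-dec walkAbove? x t w v)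
  ... | _        | no x⋠u  | _                 = no λ { (stop x⪯u) → x⋠u x⪯u ; (step _ x⪯u _) → x⋠u x⪯u }
  ... | yes refl | yes x⪯u | _                 = yes (stop x⪯u)
  ... | no _     | yes x⪯u | yes (w , e , r)   = yes (step e x⪯u r)
  ... | no u≢v   | yes _   | no ¬step          = no λ { (stop _) → u≢v refl ; (step e _ r) → ¬step (_ , e , r) }

  _⇝?[_]_ : ∀ u t x → Dec (u ⇝[ t ] x)
  u ⇝?[ t ] x = walkAbove? x t u x

  toWalk : ∀ {x t u v} → WalkAbove x t u v →
           Σ (Walk G u v) λ q → len q ≤ t × All (x ⪯_) (verts q)
  toWalk (stop x⪯u) = [] , z≤n , x⪯u ∷ []
  toWalk (step e x⪯u r) with toWalk r
  ... | q , q≤t , q-above = e ∷ q , s≤s q≤t , x⪯u ∷ q-above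

  fromWalk : ∀ {x u v} (q : Walk G u v) → All (x ⪯_) (verts q) → WalkAbove x (len q) u v
  fromWalk []      (x⪯u ∷ _)       = stop x⪯u
  fromWalk (e ∷ q) (x⪯u ∷ q-above) = step e x⪯u (fromWalk q q-above)

  suffixFrom : ∀ {u w v} (q : Walk G w v) → u ∈ verts q →
               Σ (Walk G u v) λ r → (IsPath q → IsPath r) × len r ≤ len q × verts r ⊆ verts q
  suffixFrom []      (here refl) = [] , id , ≤-refl , id
  suffixFrom (e ∷ q) (here refl) = e ∷ q , id , ≤-refl , id
  suffixFrom (e ∷ q) (there u∈q) with suffixFrom q u∈q
  ... | r , path⇒path , r≤q , r⊆q =
    r , (λ { (_ ∷ q-path) → path⇒path q-path }) , m≤n⇒m≤1+n r≤q , there ∘ r⊆q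

  -- if u recurs on the path r, drop the closed walk from u back to u
  toPath : ∀ {u v} (q : Walk G u v) →
           Σ (Walk G u v) λ r → IsPath r × len r ≤ len q × verts r ⊆ verts q
  toPath []              = [] , [] ∷ [] , z≤n , id
  toPath {u} (e ∷ q) with toPath q
  ... | r , r-path , r≤q , r⊆q with DecMembership._∈?_ Fin._≟_ u (verts r)
  ...   | no u∉r =
    e ∷ r , ¬Any⇒All¬ _ u∉r ∷ r-path , s≤s r≤q , λ { (here refl) → here refl ; (there i) → there (r⊆q i) }
  ...   | yes u∈r with suffixFrom r u∈r
  ...     | r′ , path⇒path , r′≤r , r′⊆r =
    r′ , path⇒path r-path , m≤n⇒m≤1+n (≤-trans r′≤r r≤q) , there ∘ r⊆q ∘ r′⊆r

  toPathAbove : ∀ {x t u v} → WalkAbove x t u v →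
                Σ (Walk G u v) λ q → IsPath q × len q ≤ t × All (x ⪯_) (verts q)
  toPathAbove r with toWalk r
  ... | q , q≤t , q-above with toPath q
  ...   | q′ , q′-path , q′≤q , q′⊆q = q′ , q′-path , ≤-trans q′≤q q≤t , anti-mono q′⊆q q-above

  ⇝⇒WReach : ∀ {t u x} → u ⇝[ t ] x → WReach G σ t u x
  ⇝⇒WReach u⇝x with toPathAbove u⇝x
  ... | q , q-path , q≤t , q-above = start-above u⇝x , q , q-path , q≤t , q-above

  walkAbove⇒PowAdj : ∀ {x t u v} → u ≢ v → WalkAbove x t u v → PowAdj G t u v
  walkAbove⇒PowAdj u≢v r with toPathAbove r
  ... | q , q-path , q≤t , _ = u≢v , q , q-path , q≤t

  splitAt : ∀ {u v m} (q : Walk G u v) → m ∈ verts q → All (m ⪯_) (verts q) →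
            ∃₂ λ a b → u ⇝[ a ] m × WalkAbove m b m v × a + b ≡ len q
  splitAt []      (here refl) (m⪯m ∷ _) = 0 , 0 , stop m⪯m , stop m⪯m , refl
  splitAt (e ∷ q) (here refl) q-above   = 0 , len (e ∷ q) , stop ≤-refl , fromWalk (e ∷ q) q-above , refl
  splitAt (e ∷ q) (there m∈q) (m⪯u ∷ q-above) with splitAt q m∈q q-above
  ... | a , b , w⇝m , m→v , a+b≡q = suc a , b , step e m⪯u w⇝m , m→v , cong suc a+b≡q

  first∈verts : ∀ {u v} (q : Walk G u v) → u ∈ verts q
  first∈verts []      = here refl
  first∈verts (_ ∷ _) = here refl

  lowestOf : ∀ {u v} → Walk G u v → V
  lowestOf {u} q = argmin position u (verts q)

  lowestOf∈verts : ∀ {u v} (q : Walk G u v) → lowestOf q ∈ verts q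
  lowestOf∈verts {u} q with argmin-sel position u (verts q)
  ... | inj₁ lowest≡u = subst (_∈ verts q) (sym lowest≡u) (first∈verts q)
  ... | inj₂ lowest∈q = lowest∈q

  meetAtLowest : ∀ {u v} (q : Walk G u v) →
                 ∃₂ λ a b → u ⇝[ a ] lowestOf q × v ⇝[ b ] lowestOf q × a + b ≡ len q
  meetAtLowest {u} q with splitAt q (lowestOf∈verts q) (f[argmin]≤f[xs] u (verts q))
  ... | a , b , u⇝m , m→v , a+b≡q = a , b , u⇝m , reverse m→v , a+b≡q

-- a signature gives each of the k + 1 colours either nothing or a pair (distance ≤ h, rank ≤ k)
colours : ℕ → ℕ → ℕ
colours d k = suc (suc ⌊ d /2⌋ * suc k) ^ suc k

module Subcolouring (G : Graph) (σ : Ordering G) (d k : ℕ) (wcol≤k : WcolOrdAtMost G σ d k) where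

  open WeakReachability G σ

  h : ℕ
  h = ⌊ d /2⌋

  count-⇝ : ∀ u {P : V → Set} (P? : Decidable P) → (∀ {z} → P z → u ⇝[ d ] z) →
            length (filter P? (allFin (n G))) ≤ k
  count-⇝ u P? P⇒⇝ = wcol≤k u (filter P? (allFin _)) (filter⁺ P? (allFin⁺ _))
    (All.map (⇝⇒WReach ∘ P⇒⇝) (all-filter P? (allFin _)))

  _⇝back_ : V → V → Set
  x ⇝back y = y ≺ x × x ⇝[ d ] y

  ⇝back? : ∀ x → Decidable (x ⇝back_)
  ⇝back? x y = (position y <? position x) ×-dec x ⇝?[ d ] y

  open Greedy {k = k} position {_⇝back_} ⇝back? proj₁ (λ x → count-⇝ x (⇝back? x) proj₂)
    renaming (greedy to colour; greedy-proper to colour-proper)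
    using ()

  colour-injective : ∀ {w y z a b} → w ⇝[ a ] y → w ⇝[ b ] z → a + b ≤ d →
                     colour y ≡ colour z → y ≡ z
  colour-injective {w} {y} {z} {a} {b} w⇝y w⇝z a+b≤d =
    injective-by-order colour
      (λ y≺z → ≢-sym (colour-proper (y≺z , lengthen (≤-trans (≤-reflexive (+-comm b a)) a+b≤d)
                                                    (⇝-through (<⇒≤ y≺z) w⇝z w⇝y))))
      (λ z≺y → colour-proper (z≺y , lengthen a+b≤d (⇝-through (<⇒≤ z≺y) w⇝y w⇝z)))

  ReachedBefore : V → V → V → Set
  ReachedBefore m x z = m ⇝[ d ] z × z ≺ x

  reachedBefore? : ∀ m x → Decidable (ReachedBefore m x)
  reachedBefore? m x z = m ⇝?[ d ] z ×-dec position z <? position x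

  rank : V → V → ℕ
  rank m x = length (filter (reachedBefore? m x) (allFin (n G)))

  rank≤k : ∀ m x → rank m x ≤ k
  rank≤k m x = count-⇝ m (reachedBefore? m x) proj₁

  rank-< : ∀ {m x y} → m ⇝[ d ] x → x ≺ y → rank m x < rank m y
  rank-< {m} {x} {y} m⇝x x≺y =
    length-filter-mono-< (reachedBefore? m x) (reachedBefore? m y)
      (λ (m⇝z , z≺x) → m⇝z , <-trans z≺x x≺y) (allFin (n G)) (∈-allFin x) (m⇝x , x≺y) (<-irrefl refl ∘ proj₂)

  rank-injective : ∀ {m x y} → m ⇝[ d ] x → m ⇝[ d ] y → rank m x ≡ rank m y → x ≡ y
  rank-injective {m} m⇝x m⇝y =
    injective-by-order (rank m) (<⇒≢ ∘ rank-< m⇝x) (≢-sym ∘ <⇒≢ ∘ rank-< m⇝y)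

  lowest : V → V
  lowest u = argmin position u (filter (u ⇝?[ h ]_) (allFin _))

  ⇝-lowest : ∀ u → u ⇝[ h ] lowest u
  ⇝-lowest u = argmin-all position (stop ≤-refl) (all-filter (u ⇝?[ h ]_) (allFin _))

  lowest-⪯ : ∀ {u z} → u ⇝[ h ] z → lowest u ⪯ z
  lowest-⪯ {u} {z} u⇝z = All.lookup (f[argmin]≤f[xs] u _) (∈-filter⁺ (u ⇝?[ h ]_) (∈-allFin z) u⇝z)

  ⇝-lowest-from : ∀ {u m} → u ⇝[ h ] m → m ⇝[ d ] lowest u
  ⇝-lowest-from {u} u⇝m = lengthen (⌊d/2⌋+⌊d/2⌋≤d d) (⇝-through (lowest-⪯ u⇝m) u⇝m (⇝-lowest u))

  -- the least t with u ⇝[ t ] m, truncated at h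
  dist : V → V → ℕ
  dist u m = min h (filter (u ⇝?[_] m) (upTo (suc h)))

  dist≤h : ∀ u m → dist u m ≤ h
  dist≤h u m = min≤⊤ h (filter (u ⇝?[_] m) (upTo (suc h)))

  ⇝-dist : ∀ {u m} → u ⇝[ h ] m → u ⇝[ dist u m ] m
  ⇝-dist {u} {m} u⇝m = argmin-all id u⇝m (all-filter (u ⇝?[_] m) (upTo (suc h)))

  dist-≤ : ∀ {u m a} → u ⇝[ a ] m → dist u m ≤ a
  dist-≤ {u} {m} {a} u⇝m with a ≤? h
  ... | yes a≤h = All.lookup (min≤xs h _) (∈-filter⁺ (u ⇝?[_] m) (∈-upTo⁺ (s≤s a≤h)) u⇝m)
  ... | no a≰h  = ≤-trans (dist≤h u m) (<⇒≤ (≰⇒> a≰h))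

  label : V → V → Fin (suc h * suc k)
  label u m = combine (fromℕ< (s≤s (dist≤h u m))) (fromℕ< (s≤s (rank≤k m (lowest u))))

  label-injective : ∀ {u m v m′} → label u m ≡ label v m′ →
                    dist u m ≡ dist v m′ × rank m (lowest u) ≡ rank m′ (lowest v)
  label-injective same with Finₚ.combine-injective _ _ _ _ same
  ... | same-dist , same-rank =
    Finₚ.fromℕ<-injective _ _ _ _ same-dist , Finₚ.fromℕ<-injective _ _ _ _ same-rank

  Hit : V → Fin (suc k) → V → Set
  Hit u γ m = u ⇝[ h ] m × colour m ≡ γ

  hit? : ∀ u γ → Dec (∃ (Hit u γ))
  hit? u γ = Finₚ.any? (λ m → u ⇝?[ h ] m ×-dec colour m Fin.≟ γ)

  traceOf : ∀ u γ → Dec (∃ (Hit u γ)) → Fin (suc (suc h * suc k))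
  traceOf u γ (yes (m , _)) = Fin.suc (label u m)
  traceOf u γ (no _)        = Fin.zero

  trace : V → Fin (suc k) → Fin (suc (suc h * suc k))
  trace u γ = traceOf u γ (hit? u γ)

  signature : V → Fin (colours d k)
  signature u = funToFin (trace u)

  trace-hit : ∀ {u m} → u ⇝[ h ] m → trace u (colour m) ≡ Fin.suc (label u m)
  trace-hit {u} {m} u⇝m = go (hit? u (colour m))
    where
    go : (hit : Dec (∃ (Hit u (colour m)))) → traceOf u (colour m) hit ≡ Fin.suc (label u m)
    go (yes (m₀ , u⇝m₀ , same)) = cong (Fin.suc ∘ label u) (colour-injective u⇝m₀ u⇝m (⌊d/2⌋+⌊d/2⌋≤d d) same)
    go (no none) = contradiction (m , u⇝m , refl) none

  trace-suc : ∀ {v γ c} → trace v γ ≡ Fin.suc c → ∃ λ m → Hit v γ m × label v m ≡ c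
  trace-suc {v} {γ} = go (hit? v γ)
    where
    go : ∀ {c} (hit : Dec (∃ (Hit v γ))) → traceOf v γ hit ≡ Fin.suc c → ∃ λ m → Hit v γ m × label v m ≡ c
    go (yes (m , hit)) same = m , hit , Finₚ.suc-injective same
    go (no _)          ()

  -- The colour of m picks out the entries of both signatures describing m; minimality of dist
  -- then forces the vertex of that colour seen from v to be m itself.
  same-signature-meet : ∀ {u v m a b} → signature u ≡ signature v →
                        u ⇝[ a ] m → v ⇝[ b ] m → a ≤ b → a + b ≤ d →
                        v ⇝[ h ] m × rank m (lowest u) ≡ rank m (lowest v)
  same-signature-meet {u} {v} {m} {a} {b} same u⇝m v⇝m a≤b a+b≤d = meet (trace-suc same-trace)
    where
    u⇝ʰm : u ⇝[ h ] m
    u⇝ʰm = lengthen (a≤⌊d/2⌋ a≤b a+b≤d) u⇝m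

    same-trace : trace v (colour m) ≡ Fin.suc (label u m)
    same-trace = trans (sym (funToFin-injective (trace u) (trace v) same (colour m))) (trace-hit u⇝ʰm)

    meet : (∃ λ m′ → Hit v (colour m) m′ × label v m′ ≡ label u m) →
           v ⇝[ h ] m × rank m (lowest u) ≡ rank m (lowest v)
    meet (m′ , (v⇝m′ , cm′≡cm) , same-label) =
      subst (v ⇝[ h ]_) m′≡m v⇝m′ , trans (sym same-rank) (cong (λ x → rank x (lowest v)) m′≡m)
      where
      same-dist : dist v m′ ≡ dist u m
      same-dist = proj₁ (label-injective {v} {m′} {u} {m} same-label)

      same-rank : rank m′ (lowest v) ≡ rank m (lowest u)
      same-rank = proj₂ (label-injective {v} {m′} {u} {m} same-label)

      m′≡m : m′ ≡ m
      m′≡m = colour-injective (⇝-dist v⇝m′) v⇝m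
        (≤-trans (+-monoˡ-≤ b (≤-trans (≤-reflexive same-dist) (dist-≤ u⇝m))) a+b≤d) cm′≡cm

  same-signature⇒same-lowest-≤ : ∀ {u v m a b} → signature u ≡ signature v →
                                 u ⇝[ a ] m → v ⇝[ b ] m → a ≤ b → a + b ≤ d → lowest u ≡ lowest v
  same-signature⇒same-lowest-≤ same u⇝m v⇝m a≤b a+b≤d =
    let v⇝ʰm , same-rank = same-signature-meet same u⇝m v⇝m a≤b a+b≤d
    in rank-injective (⇝-lowest-from (lengthen (a≤⌊d/2⌋ a≤b a+b≤d) u⇝m)) (⇝-lowest-from v⇝ʰm) same-rank

  same-signature⇒same-lowest : ∀ {u v m a b} → signature u ≡ signature v →
                               u ⇝[ a ] m → v ⇝[ b ] m → a + b ≤ d → lowest u ≡ lowest v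
  same-signature⇒same-lowest {u} {v} {a = a} {b} same u⇝m v⇝m a+b≤d = by-order (≤-total a b)
    where
    by-order : a ≤ b ⊎ b ≤ a → lowest u ≡ lowest v
    by-order (inj₁ a≤b) = same-signature⇒same-lowest-≤ same u⇝m v⇝m a≤b a+b≤d
    by-order (inj₂ b≤a) =
      sym (same-signature⇒same-lowest-≤ (sym same) v⇝m u⇝m b≤a (subst (_≤ d) (+-comm a b) a+b≤d))

  same-lowest⇒PowAdj : ∀ {u v} → u ≢ v → lowest u ≡ lowest v → PowAdj G d u v
  same-lowest⇒PowAdj {u} {v} u≢v same = walkAbove⇒PowAdj u≢v
    (lengthen (⌊d/2⌋+⌊d/2⌋≤d d) (⇝-lowest u ++ reverse (subst (v ⇝[ h ]_) (sym same) (⇝-lowest v))))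

  PowAdj⇒same-lowest : ∀ {u v} → signature u ≡ signature v → PowAdj G d u v → lowest u ≡ lowest v
  PowAdj⇒same-lowest same (_ , q , _ , q≤d) =
    let a , b , u⇝m , v⇝m , a+b≡q = meetAtLowest q
    in same-signature⇒same-lowest same u⇝m v⇝m (subst (_≤ d) (sym a+b≡q) q≤d)

  subcolouring : SubColouring (n G) (PowAdj G d) (colours d k)
  subcolouring = signature , toℕ ∘ lowest , λ u v same u≢v →
    (same-lowest⇒PowAdj u≢v ∘ Finₚ.toℕ-injective) , (cong toℕ ∘ PowAdj⇒same-lowest same)

theorem4p5 : (d : ℕ) → ∃ λ (f : ℕ → ℕ) →
    (G : Graph) (k : ℕ) → IsWcol G d k →
    SubChromaticAtMost (n G) (PowAdj G d) (f k)
theorem4p5 d = colours d , λ G k (((σ , wcol≤k) , _)) → Subcolouring.subcolouring G σ d k wcol≤k
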